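{- Order $\mathbb{Q}$ by the Stern-Brocot enumeration extended to all rationals, i.e. as $0, q_1, -q_1, q_2, -q_2, \dots$ where $q_1,q_2,\dots$ is the Stern-Brocot enumeration of $\mathbb{Q}^+$. Then with respect to this ordering the asymptotic density in $\mathbb{Q}$ of each of the parity classes $\mathbb{Q}_\mathrm{E}$, $\mathbb{Q}_\mathrm{O}$, $\mathbb{Q}_\mathrm{N}$ is $\frac{1}{3}$.
   Context: Write each rational in lowest terms $m/n$ with $n>0$, $\gcd(m,n)=1$. Its parity is: even if $m$ is even (hence $n$ odd; in particular $0=0/1$ is even); odd if $m$ and $n$ are both odd; none if $n$ is even. $\mathbb{Q}_\mathrm{E},\mathbb{Q}_\mathrm{O},\mathbb{Q}_\mathrm{N}$ are the sets of rationals of parity even, odd, none respectively. The Stern-Brocot process: level $0$ is the sequence $0/1,\ 1/0$; level $j+1$ is obtained from level $j$ by inserting, between every two adjacent entries $m_1/n_1$ and $m_2/n_2$, their mediant $(m_1+m_2)/(n_1+n_2)$, keeping all existing entries. Every positive rational appears exactly once as a newly inserted entry (in lowest terms). The Stern-Brocot enumeration $q_1,q_2,\dots$ of $\mathbb{Q}^+$ lists the entries newly inserted at level $1$, then those newly inserted at level $2$, and so on, each level's new entries from left to right. For a countable set $X$ enumerated as $x_1,x_2,\dots$ and $A\subseteq X$, the asymptotic density of $A$ in $X$ is $\rho_X(A)=\lim_{n\to\infty}|A\cap\{x_1,\dots,x_n\}|/n$ when the limit exists. -}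

module Defs where

open import Data.Nat as ℕ using (ℕ; zero; suc; _%_; _≡ᵇ_)
open import Data.Integer as ℤ using (+_)
open import Data.Rational using (ℚ; ↥_; ↧ₙ_; _/_; -_; 0ℚ; ∣_∣; _-_; _<_)
open import Data.Product using (_×_; _,_; ∃)
open import Data.List using (List; []; _∷_; concatMap; length; filterᵇ; map; upTo)
open import Data.Bool using (Bool; true; false)

-- A fraction m/n is represented as a pair (m , n) of naturals (n may be 0, for 1/0).
Frac : Set
Frac = ℕ × ℕ

mediant : Frac → Frac → Frac
mediant (m₁ , n₁) (m₂ , n₂) = (m₁ ℕ.+ m₂ , n₁ ℕ.+ n₂)

refine : List Frac → List Frac
refine [] = []
refine (a ∷ []) = a ∷ []
refine (a ∷ b ∷ rest) = a ∷ mediant a b ∷ refine (b ∷ rest)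

mediants : List Frac → List Frac
mediants [] = []
mediants (a ∷ []) = []
mediants (a ∷ b ∷ rest) = mediant a b ∷ mediants (b ∷ rest)

level : ℕ → List Frac
level zero = (0 , 1) ∷ (1 , 0) ∷ []
level (suc j) = refine (level j)

newAt : ℕ → List Frac
newAt j = mediants (level j)

-- value of a fraction m/n as a rational (the n = 0 branch never occurs for
-- newly inserted entries, whose denominators are ≥ 1)
toℚ : Frac → ℚ
toℚ (m , zero) = 0ℚ
toℚ (m , suc k) = (+ m) / suc k

upToLevel : ℕ → List Frac
upToLevel k = concatMap newAt (upTo k)

nth : List ℚ → ℕ → ℚ
nth [] _ = 0ℚ
nth (x ∷ xs) zero = x
nth (x ∷ xs) (suc i) = nth xs i

-- Stern-Brocot enumeration of ℚ⁺, 0-indexed: sbQ⁺ 0 = q₁, sbQ⁺ 1 = q₂, ...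
-- (levels 1..k+1 contain at least k+1 new entries)
sbQ⁺ : ℕ → ℚ
sbQ⁺ k = nth (map toℚ (upToLevel (suc k))) k

-- enumeration of ℚ : 0, q₁, -q₁, q₂, -q₂, ...   (0-indexed):
-- index 0 ↦ 0, index 2k+1 ↦ q_{k+1}, index 2k+2 ↦ -q_{k+1}
enumℚ : ℕ → ℚ
enumℚ zero = 0ℚ
enumℚ (suc i) with i % 2
... | zero = sbQ⁺ (i ℕ./ 2)
... | suc _ = - sbQ⁺ (i ℕ./ 2)

-- parity of a rational m/n in lowest terms (ℚ is stored normalised)
data Parity : Set where
  evenP oddP noneP : Parity

parity : ℚ → Parity
parity q with ℤ.∣ ↥ q ∣ % 2 | ↧ₙ q % 2
... | zero | _ = evenP
... | suc _ | zero = noneP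
... | suc _ | suc _ = oddP

_≟ₚ_ : Parity → Parity → Bool
evenP ≟ₚ evenP = true
oddP ≟ₚ oddP = true
noneP ≟ₚ noneP = true
_ ≟ₚ _ = false

count : (ℕ → ℚ) → Parity → ℕ → ℕ
count x c n = length (filterᵇ (λ i → parity (x i) ≟ₚ c) (upTo n))

ratio : (ℕ → ℚ) → Parity → ℕ → ℚ
ratio x c zero = 0ℚ
ratio x c (suc n) = (+ count x c (suc n)) / suc n

HasDensity : (ℕ → ℚ) → Parity → ℚ → Set
HasDensity x c d = ∀ (ε : ℚ) → 0ℚ < ε → ∃ λ N → ∀ n → N ℕ.≤ n → ∣ ratio x c (suc n) - d ∣ < ε

-- Reduce numerators and denominators mod 2.  The mediant becomes addition in 𝔽₂², so each
-- Stern-Brocot level is, mod 2, a Fibonacci sequence x, y, x + y, x, y, ... in 𝔽₂², which has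
-- period 3 and runs through the three nonzero residues; the 2^j entries new at level j + 1 are
-- consecutive terms of such a sequence.  As 4^i ≡ 1 (mod 3), the new entries of the levels
-- 2i + 1 and 2i + 2 split into consecutive triples of the three residues 1/1, 1/0, 0/1, and
-- hence so does the whole sequence q₁, q₂, ...  A nonzero residue forces an odd gcd, so it
-- survives cancellation to lowest terms, and 0/1, 1/1, 1/0 are exactly the classes even, odd,
-- none.  So each class contains one of q₃ₘ₊₁, q₃ₘ₊₂, q₃ₘ₊₃, its count among the first n
-- terms of 0, q₁, -q₁, q₂, -q₂, ... is n/3 + O(1), and the density is 1/3.
module Submission where

open import Defs
open import Data.Bool using (Bool; true; false; not; _xor_; _∧_)
import Data.Bool.Properties as BoolP
open import Data.Empty using (⊥-elim)
open import Data.Integer as ℤ using (+_; +[1+_]; -[1+_]; _⊖_)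
import Data.Integer.Properties as ℤP
open import Data.List using (List; []; _∷_; _++_; map; length; concat; concatMap; upTo; applyUpTo; filterᵇ)
import Data.List.Properties as ListP
open import Data.List.Relation.Unary.All using (All; []; _∷_)
import Data.List.Relation.Unary.All.Properties as AllP
open import Data.Nat as ℕ using (ℕ; zero; suc; _+_; _*_; _^_; _≤_; _<_; z≤n; s≤s; ∣_-_∣)
open import Data.Nat.DivMod using (_%_; [m+n]%n≡m%n; m*n/n≡m; +-distrib-/-∣ʳ)
open import Data.Nat.Divisibility using (divides-refl)
open import Data.Nat.GCD using (gcd)
import Data.Nat.Properties as ℕP
open import Data.Nat.Tactic.RingSolver using (solve-∀)
open import Data.Product using (_×_; _,_; proj₁; proj₂; ∃)
open import Data.Rational as ℚ using (mkℚ; ↥_; ↧_; ↧ₙ_; normalize; toℚᵘ; _/_)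
import Data.Rational.Properties as ℚP
open import Data.Rational.Unnormalised as ℚᵘ using (mkℚᵘ; *<*)
import Data.Rational.Unnormalised.Properties as ℚᵘP
open import Data.Sum using (_⊎_; inj₁; inj₂)
open import Data.Unit using (⊤; tt)
open import Function using (_∘_)
open import Relation.Binary.PropositionalEquality

odd : ℕ → Bool
odd zero    = false
odd (suc n) = not (odd n)

odd-+ : ∀ m n → odd (m + n) ≡ odd m xor odd n
odd-+ zero    n = refl
odd-+ (suc m) n = trans (cong not (odd-+ m n)) (BoolP.not-distribˡ-xor (odd m) (odd n))

odd-* : ∀ m n → odd (m * n) ≡ odd m ∧ odd n
odd-* zero    n = refl
odd-* (suc m) n = begin
  odd (n + m * n)             ≡⟨ odd-+ n (m * n) ⟩
  odd n xor odd (m * n)       ≡⟨ cong (odd n xor_) (odd-* m n) ⟩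
  odd n xor (odd m ∧ odd n)   ≡⟨ lemma (odd m) (odd n) ⟩
  not (odd m) ∧ odd n         ∎
  where
  open ≡-Reasoning
  lemma : ∀ a b → b xor (a ∧ b) ≡ not a ∧ b
  lemma false b = BoolP.xor-identityʳ b
  lemma true  b = BoolP.xor-same b

odd-*2 : ∀ n → odd (n * 2) ≡ false
odd-*2 zero    = refl
odd-*2 (suc n) = cong (not ∘ not) (odd-*2 n)

-- 𝔽₂², with true for odd
Mod2 : Set
Mod2 = Bool × Bool

_⊕_ : Mod2 → Mod2 → Mod2
x ⊕ y = proj₁ x xor proj₁ y , proj₂ x xor proj₂ y

xor-cancelˡ : ∀ a b → a xor (a xor b) ≡ b
xor-cancelˡ false b = refl
xor-cancelˡ true  b = BoolP.not-involutive b

xor-cancelʳ : ∀ a b → (a xor b) xor b ≡ a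
xor-cancelʳ false b = BoolP.xor-same b
xor-cancelʳ true  b = BoolP.xor-inverseˡ b

⊕-comm : ∀ x y → x ⊕ y ≡ y ⊕ x
⊕-comm (a , b) (c , d) = cong₂ _,_ (BoolP.xor-comm a c) (BoolP.xor-comm b d)

x⊕[x⊕y]≡y : ∀ x y → x ⊕ (x ⊕ y) ≡ y
x⊕[x⊕y]≡y (a , b) (c , d) = cong₂ _,_ (xor-cancelˡ a c) (xor-cancelˡ b d)

[x⊕y]⊕y≡x : ∀ x y → (x ⊕ y) ⊕ y ≡ x
[x⊕y]⊕y≡x (a , b) (c , d) = cong₂ _,_ (xor-cancelʳ a c) (xor-cancelʳ b d)

y⊕[x⊕y]≡x : ∀ x y → y ⊕ (x ⊕ y) ≡ x
y⊕[x⊕y]≡x x y = trans (cong (y ⊕_) (⊕-comm x y)) (x⊕[x⊕y]≡y y x)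

[x⊕y]⊕x≡y : ∀ x y → (x ⊕ y) ⊕ x ≡ y
[x⊕y]⊕x≡y x y = trans (cong (_⊕ x) (⊕-comm x y)) ([x⊕y]⊕y≡x y x)

[0/1] [1/0] [1/1] : Mod2
[0/1] = false , true
[1/0] = true  , false
[1/1] = true  , true

residue : Frac → Mod2
residue (m , n) = odd m , odd n

residue-mediant : ∀ a b → residue (mediant a b) ≡ residue a ⊕ residue b
residue-mediant (m₁ , n₁) (m₂ , n₂) = cong₂ _,_ (odd-+ m₁ m₂) (odd-+ n₁ n₂)

-- The Stern-Brocot levels mod 2

refineWith : {A : Set} → (A → A → A) → List A → List A
refineWith _∙_ []            = []
refineWith _∙_ (a ∷ [])      = a ∷ []
refineWith _∙_ (a ∷ b ∷ l)   = a ∷ a ∙ b ∷ refineWith _∙_ (b ∷ l)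

mediantsWith : {A : Set} → (A → A → A) → List A → List A
mediantsWith _∙_ []          = []
mediantsWith _∙_ (a ∷ [])    = []
mediantsWith _∙_ (a ∷ b ∷ l) = a ∙ b ∷ mediantsWith _∙_ (b ∷ l)

map-refine : ∀ l → map residue (refine l) ≡ refineWith _⊕_ (map residue l)
map-refine []          = refl
map-refine (a ∷ [])    = refl
map-refine (a ∷ b ∷ l) = cong₂ (λ m r → residue a ∷ m ∷ r) (residue-mediant a b) (map-refine (b ∷ l))

map-mediants : ∀ l → map residue (mediants l) ≡ mediantsWith _⊕_ (map residue l)
map-mediants []          = refl
map-mediants (a ∷ [])    = refl
map-mediants (a ∷ b ∷ l) = cong₂ _∷_ (residue-mediant a b) (map-mediants (b ∷ l))

fib : Mod2 → Mod2 → ℕ → List Mod2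
fib x y zero    = []
fib x y (suc n) = x ∷ fib y (x ⊕ y) n

fib-cong : ∀ {x x′ y y′ n n′} → x ≡ x′ → y ≡ y′ → n ≡ n′ → fib x y n ≡ fib x′ y′ n′
fib-cong refl refl refl = refl

length-fib : ∀ x y n → length (fib x y n) ≡ n
length-fib x y zero    = refl
length-fib x y (suc n) = cong suc (length-fib y (x ⊕ y) n)

fib-period : ∀ x y n → fib x y (3 + n) ≡ x ∷ y ∷ x ⊕ y ∷ fib x y n
fib-period x y n = cong (λ l → x ∷ y ∷ x ⊕ y ∷ l) (cong₂ (λ u v → fib u v n) third fourth)
  where
  third : y ⊕ (x ⊕ y) ≡ x
  third = y⊕[x⊕y]≡x x y
  fourth : (x ⊕ y) ⊕ (y ⊕ (x ⊕ y)) ≡ y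
  fourth = trans (cong ((x ⊕ y) ⊕_) third) ([x⊕y]⊕x≡y x y)

fib-++ : ∀ x y m n → fib x y (m * 3 + n) ≡ fib x y (m * 3) ++ fib x y n
fib-++ x y zero    n = refl
fib-++ x y (suc m) n = begin
  fib x y (3 + (m * 3 + n))                   ≡⟨ fib-period x y (m * 3 + n) ⟩
  x ∷ y ∷ x ⊕ y ∷ fib x y (m * 3 + n)         ≡⟨ cong (λ l → x ∷ y ∷ x ⊕ y ∷ l) (fib-++ x y m n) ⟩
  x ∷ y ∷ x ⊕ y ∷ fib x y (m * 3) ++ fib x y n ≡⟨ cong (_++ fib x y n) (fib-period x y (m * 3)) ⟨
  fib x y (3 + m * 3) ++ fib x y n             ∎
  where open ≡-Reasoning

refine-fib : ∀ x y n → refineWith _⊕_ (fib x y (suc n)) ≡ fib x (x ⊕ y) (suc (n + n))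
refine-fib x y zero    = refl
refine-fib x y (suc n) = cong (λ l → x ∷ x ⊕ y ∷ l) (trans (refine-fib y (x ⊕ y) n)
  (fib-cong (sym (x⊕[x⊕y]≡y x y)) (trans (⊕-comm y (x ⊕ y)) (cong ((x ⊕ y) ⊕_) (sym (x⊕[x⊕y]≡y x y))))
            (sym (ℕP.+-suc n n))))

mediants-fib : ∀ x y n → mediantsWith _⊕_ (fib x y (suc n)) ≡ fib (x ⊕ y) x n
mediants-fib x y zero    = refl
mediants-fib x y (suc n) = cong (x ⊕ y ∷_) (trans (mediants-fib y (x ⊕ y) n)
  (fib-cong (y⊕[x⊕y]≡x x y) (sym ([x⊕y]⊕x≡y x y)) refl))

residue-level : ∀ j → map residue (level j) ≡ fib [0/1] (true , odd j) (suc (2 ^ j))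
residue-level zero    = refl
residue-level (suc j) = begin
  map residue (refine (level j))                           ≡⟨ map-refine (level j) ⟩
  refineWith _⊕_ (map residue (level j))                   ≡⟨ cong (refineWith _⊕_) (residue-level j) ⟩
  refineWith _⊕_ (fib [0/1] (true , odd j) (suc (2 ^ j))) ≡⟨ refine-fib [0/1] (true , odd j) (2 ^ j) ⟩
  fib [0/1] (true , odd (suc j)) (suc (2 ^ j + 2 ^ j))     ≡⟨ cong (λ n → fib [0/1] (true , odd (suc j)) (suc (2 ^ j + n))) (ℕP.+-identityʳ (2 ^ j)) ⟨
  fib [0/1] (true , odd (suc j)) (suc (2 ^ suc j))         ∎
  where open ≡-Reasoning

residue-newAt : ∀ j → map residue (newAt j) ≡ fib (true , odd (suc j)) [0/1] (2 ^ j)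
residue-newAt j = begin
  map residue (mediants (level j))                         ≡⟨ map-mediants (level j) ⟩
  mediantsWith _⊕_ (map residue (level j))                 ≡⟨ cong (mediantsWith _⊕_) (residue-level j) ⟩
  mediantsWith _⊕_ (fib [0/1] (true , odd j) (suc (2 ^ j))) ≡⟨ mediants-fib [0/1] (true , odd j) (2 ^ j) ⟩
  fib (true , odd (suc j)) [0/1] (2 ^ j)                   ∎
  where open ≡-Reasoning

-- Triples of distinct nonzero residues

Nonzero : Mod2 → Set
Nonzero x = x ≢ (false , false)

IsBasis : Mod2 → Mod2 → Set
IsBasis x y = Nonzero x × Nonzero y × Nonzero (x ⊕ y)

data Triples : List Mod2 → Set where
  []  : Triples []
  _∷_ : ∀ {x y l} → IsBasis x y → Triples l → Triples (x ∷ y ∷ x ⊕ y ∷ l)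

Triples-++ : ∀ {l r} → Triples l → Triples r → Triples (l ++ r)
Triples-++ []      tr = tr
Triples-++ (b ∷ t) tr = b ∷ Triples-++ t tr

Triples-fib : ∀ {x y} → IsBasis x y → ∀ m → Triples (fib x y (m * 3))
Triples-fib b zero    = []
Triples-fib {x} {y} b (suc m) = subst Triples (sym (fib-period x y (m * 3))) (b ∷ Triples-fib b m)

Triples-nonzero : ∀ {l} → Triples l → All Nonzero l
Triples-nonzero []                      = []
Triples-nonzero ((nx , ny , nxy) ∷ t) = nx ∷ ny ∷ nxy ∷ Triples-nonzero t

2^[2i]≡3a+1 : ∀ i → ∃ λ a → 2 ^ (i * 2) ≡ a * 3 + 1
2^[2i]≡3a+1 zero    = 0 , refl
2^[2i]≡3a+1 (suc i) with 2^[2i]≡3a+1 i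
... | a , eq = a * 4 + 1 , trans (cong (λ z → 2 * (2 * z)) eq) (lemma a)
  where
  lemma : ∀ a → 2 * (2 * (a * 3 + 1)) ≡ (a * 4 + 1) * 3 + 1
  lemma = solve-∀

Triples-newAt-pair : ∀ i → Triples (map residue (newAt (i * 2) ++ newAt (suc (i * 2))))
Triples-newAt-pair i with 2^[2i]≡3a+1 i
... | a , eq = subst Triples (sym residues)
  (Triples-++ (Triples-fib basis₁ a) (basis₂ ∷ Triples-fib basis₂ (a * 2)))
  where
  basis₁ : IsBasis [1/1] [0/1]
  basis₁ = (λ ()) , (λ ()) , (λ ())
  basis₂ : IsBasis [1/1] [1/0]
  basis₂ = (λ ()) , (λ ()) , (λ ())
  2^[2i+1] : 2 ^ suc (i * 2) ≡ 2 + a * 2 * 3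
  2^[2i+1] = trans (cong (2 *_) eq) (lemma a)
    where
    lemma : ∀ a → 2 * (a * 3 + 1) ≡ 2 + a * 2 * 3
    lemma = solve-∀
  residues : map residue (newAt (i * 2) ++ newAt (suc (i * 2)))
           ≡ fib [1/1] [0/1] (a * 3) ++ [1/1] ∷ [1/0] ∷ [0/1] ∷ fib [1/1] [1/0] (a * 2 * 3)
  residues = begin
    map residue (newAt (i * 2) ++ newAt (suc (i * 2)))
      ≡⟨ ListP.map-++ residue (newAt (i * 2)) _ ⟩
    map residue (newAt (i * 2)) ++ map residue (newAt (suc (i * 2)))
      ≡⟨ cong₂ _++_ (residue-newAt (i * 2)) (residue-newAt (suc (i * 2))) ⟩
    fib (true , not (odd (i * 2))) [0/1] (2 ^ (i * 2)) ++ fib (true , not (not (odd (i * 2)))) [0/1] (2 ^ suc (i * 2))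
      ≡⟨ cong₂ _++_ (fib-cong (cong (λ b → true , not b) (odd-*2 i)) refl (trans eq (ℕP.+-comm (a * 3) 1)))
                    (fib-cong (cong (λ b → true , not (not b)) (odd-*2 i)) refl 2^[2i+1]) ⟩
    fib [1/1] [0/1] (1 + a * 3) ++ fib [1/0] [0/1] (2 + a * 2 * 3)
      ≡⟨ cong (_++ fib [1/0] [0/1] (2 + a * 2 * 3)) (trans (cong (fib [1/1] [0/1]) (ℕP.+-comm 1 (a * 3))) (fib-++ [1/1] [0/1] a 1)) ⟩
    (fib [1/1] [0/1] (a * 3) ++ [1/1] ∷ []) ++ fib [1/0] [0/1] (2 + a * 2 * 3)
      ≡⟨ ListP.++-assoc (fib [1/1] [0/1] (a * 3)) _ _ ⟩
    fib [1/1] [0/1] (a * 3) ++ [1/1] ∷ [1/0] ∷ [0/1] ∷ fib [1/1] [1/0] (a * 2 * 3) ∎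
    where open ≡-Reasoning

upToLevel-suc : ∀ k → upToLevel (suc k) ≡ upToLevel k ++ newAt k
upToLevel-suc k = begin
  concatMap newAt (upTo (suc k))                   ≡⟨ cong (concatMap newAt) (ListP.upTo-∷ʳ k) ⟨
  concat (map newAt (upTo k ++ k ∷ []))            ≡⟨ cong concat (ListP.map-++ newAt (upTo k) (k ∷ [])) ⟩
  concat (map newAt (upTo k) ++ newAt k ∷ [])      ≡⟨ ListP.concat-++ (map newAt (upTo k)) (newAt k ∷ []) ⟨
  upToLevel k ++ newAt k ++ []                     ≡⟨ cong (upToLevel k ++_) (ListP.++-identityʳ (newAt k)) ⟩
  upToLevel k ++ newAt k                           ∎
  where open ≡-Reasoning

upToLevel-prefix : ∀ {k L} → k ≤ L → ∃ λ r → upToLevel L ≡ upToLevel k ++ r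
upToLevel-prefix {L = zero} z≤n = [] , refl
upToLevel-prefix {k} {suc L} k≤1+L with ℕP.m≤n⇒m<n∨m≡n k≤1+L
... | inj₂ refl = [] , sym (ListP.++-identityʳ _)
... | inj₁ (s≤s k≤L) with upToLevel-prefix k≤L
...   | r , eq = r ++ newAt L , (begin
  upToLevel (suc L)             ≡⟨ upToLevel-suc L ⟩
  upToLevel L ++ newAt L        ≡⟨ cong (_++ newAt L) eq ⟩
  (upToLevel k ++ r) ++ newAt L ≡⟨ ListP.++-assoc (upToLevel k) r (newAt L) ⟩
  upToLevel k ++ r ++ newAt L   ∎)
  where open ≡-Reasoning

length-newAt : ∀ j → length (newAt j) ≡ 2 ^ j
length-newAt j = begin
  length (newAt j)                               ≡⟨ ListP.length-map residue (newAt j) ⟨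
  length (map residue (newAt j))                  ≡⟨ cong length (residue-newAt j) ⟩
  length (fib (true , odd (suc j)) [0/1] (2 ^ j)) ≡⟨ length-fib _ _ (2 ^ j) ⟩
  2 ^ j                                          ∎
  where open ≡-Reasoning

length-upToLevel : ∀ L → L ≤ length (upToLevel L)
length-upToLevel zero    = z≤n
length-upToLevel (suc L) = begin
  suc L                                       ≡⟨ ℕP.+-comm 1 L ⟩
  L + 1                                       ≤⟨ ℕP.+-mono-≤ (length-upToLevel L) (ℕP.m^n>0 2 L) ⟩
  length (upToLevel L) + 2 ^ L                ≡⟨ cong₂ _+_ refl (length-newAt L) ⟨
  length (upToLevel L) + length (newAt L)     ≡⟨ ListP.length-++ (upToLevel L) ⟨
  length (upToLevel L ++ newAt L)             ≡⟨ cong length (upToLevel-suc L) ⟨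
  length (upToLevel (suc L))                  ∎
  where open ℕP.≤-Reasoning

Triples-upToLevel : ∀ L → Triples (map residue (upToLevel (L * 2)))
Triples-upToLevel zero    = []
Triples-upToLevel (suc L) = subst Triples (sym residues)
  (Triples-++ (Triples-upToLevel L) (Triples-newAt-pair L))
  where
  open ≡-Reasoning
  residues : map residue (upToLevel (2 + L * 2)) ≡ map residue (upToLevel (L * 2)) ++ map residue (newAt (L * 2) ++ newAt (suc (L * 2)))
  residues = begin
    map residue (upToLevel (2 + L * 2))
      ≡⟨ cong (map residue) (trans (upToLevel-suc (suc (L * 2))) (cong (_++ newAt (suc (L * 2))) (upToLevel-suc (L * 2)))) ⟩
    map residue ((upToLevel (L * 2) ++ newAt (L * 2)) ++ newAt (suc (L * 2)))
      ≡⟨ cong (map residue) (ListP.++-assoc (upToLevel (L * 2)) _ _) ⟩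
    map residue (upToLevel (L * 2) ++ newAt (L * 2) ++ newAt (suc (L * 2)))
      ≡⟨ ListP.map-++ residue (upToLevel (L * 2)) _ ⟩
    map residue (upToLevel (L * 2)) ++ map residue (newAt (L * 2) ++ newAt (suc (L * 2))) ∎

Pos : Frac → Set
Pos (_ , n) = 0 < n

-- Only the last entry 1/0 of a level has denominator 0 (and toℚ sends it to 0).
PosButLast : List Frac → Set
PosButLast []          = ⊤
PosButLast (a ∷ [])    = ⊤
PosButLast (a ∷ b ∷ l) = Pos a × PosButLast (b ∷ l)

Pos-mediant : ∀ a b → Pos a → Pos (mediant a b)
Pos-mediant (_ , n₁) (_ , n₂) p = ℕP.≤-trans p (ℕP.m≤m+n n₁ n₂)

PosButLast-refine : ∀ l → PosButLast l → PosButLast (refine l)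
PosButLast-refine []              _        = tt
PosButLast-refine (a ∷ [])        _        = tt
PosButLast-refine (a ∷ b ∷ [])    (pa , _) = pa , Pos-mediant a b pa , tt
PosButLast-refine (a ∷ b ∷ c ∷ l) (pa , p) = pa , Pos-mediant a b pa , PosButLast-refine (b ∷ c ∷ l) p

PosButLast-level : ∀ j → PosButLast (level j)
PosButLast-level zero    = s≤s z≤n , tt
PosButLast-level (suc j) = PosButLast-refine (level j) (PosButLast-level j)

All-Pos-mediants : ∀ l → PosButLast l → All Pos (mediants l)
All-Pos-mediants []          _        = []
All-Pos-mediants (a ∷ [])    _        = []
All-Pos-mediants (a ∷ b ∷ l) (pa , p) = Pos-mediant a b pa ∷ All-Pos-mediants (b ∷ l) p

All-Pos-upToLevel : ∀ L → All Pos (upToLevel L)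
All-Pos-upToLevel zero    = []
All-Pos-upToLevel (suc L) = subst (All Pos) (sym (upToLevel-suc L))
  (AllP.++⁺ (All-Pos-upToLevel L) (All-Pos-mediants (level L) (PosButLast-level L)))

bit : Bool → ℕ
bit false = 0
bit true  = 1

classOf : Mod2 → Parity
classOf (false , _)    = evenP
classOf (true , false) = noneP
classOf (true , true)  = oddP

Rainbow : Parity → Parity → Parity → Set
Rainbow p q r = ∀ c → bit (p ≟ₚ c) + bit (q ≟ₚ c) + bit (r ≟ₚ c) ≡ 1

Rainbow-cong : ∀ {p p′ q q′ r r′} → p ≡ p′ → q ≡ q′ → r ≡ r′ → Rainbow p′ q′ r′ → Rainbow p q r
Rainbow-cong refl refl refl rainbow = rainbow

Rainbow-classOf : ∀ {x y} → IsBasis x y → Rainbow (classOf x) (classOf y) (classOf (x ⊕ y))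
Rainbow-classOf {false , false} (nx , _)      = ⊥-elim (nx refl)
Rainbow-classOf {_} {false , false} (_ , ny , _) = ⊥-elim (ny refl)
Rainbow-classOf {false , true}  {false , true}  (_ , _ , nxy) = ⊥-elim (nxy refl)
Rainbow-classOf {true , false}  {true , false}  (_ , _ , nxy) = ⊥-elim (nxy refl)
Rainbow-classOf {true , true}   {true , true}   (_ , _ , nxy) = ⊥-elim (nxy refl)
Rainbow-classOf {false , true}  {true , false} _ = λ { evenP → refl ; oddP → refl ; noneP → refl }
Rainbow-classOf {false , true}  {true , true}  _ = λ { evenP → refl ; oddP → refl ; noneP → refl }
Rainbow-classOf {true , false}  {false , true} _ = λ { evenP → refl ; oddP → refl ; noneP → refl }
Rainbow-classOf {true , false}  {true , true}  _ = λ { evenP → refl ; oddP → refl ; noneP → refl }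
Rainbow-classOf {true , true}   {false , true} _ = λ { evenP → refl ; oddP → refl ; noneP → refl }
Rainbow-classOf {true , true}   {true , false} _ = λ { evenP → refl ; oddP → refl ; noneP → refl }

n%2≡bit[odd-n] : ∀ n → n % 2 ≡ bit (odd n)
n%2≡bit[odd-n] zero          = refl
n%2≡bit[odd-n] (suc zero)    = refl
n%2≡bit[odd-n] (suc (suc n)) = begin
  (2 + n) % 2           ≡⟨ cong (_% 2) (ℕP.+-comm 2 n) ⟩
  (n + 2) % 2           ≡⟨ [m+n]%n≡m%n n 2 ⟩
  n % 2                 ≡⟨ n%2≡bit[odd-n] n ⟩
  bit (odd n)           ≡⟨ cong bit (BoolP.not-involutive (odd n)) ⟨
  bit (not (not (odd n))) ∎
  where open ≡-Reasoning

parity≡classOf : ∀ q → parity q ≡ classOf (odd ℤ.∣ ↥ q ∣ , odd (↧ₙ q))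
parity≡classOf q rewrite n%2≡bit[odd-n] ℤ.∣ ↥ q ∣ | n%2≡bit[odd-n] (↧ₙ q)
  with odd ℤ.∣ ↥ q ∣ | odd (↧ₙ q)
... | false | _     = refl
... | true  | false = refl
... | true  | true  = refl

cancel-odd-factor : ∀ u v w → Nonzero (u ∧ w , v ∧ w) → (u ∧ w , v ∧ w) ≡ (u , v)
cancel-odd-factor u v true  _  = cong₂ _,_ (BoolP.∧-identityʳ u) (BoolP.∧-identityʳ v)
cancel-odd-factor u v false nz = ⊥-elim (nz (cong₂ _,_ (BoolP.∧-zeroʳ u) (BoolP.∧-zeroʳ v)))

-- As m and n are not both even, gcd m n is odd, so cancelling it keeps the residues.
parity-toℚ : ∀ f → Pos f → Nonzero (residue f) → parity (toℚ f) ≡ classOf (residue f)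
parity-toℚ (m , suc k) _ nz = begin
  parity q                                   ≡⟨ parity≡classOf q ⟩
  classOf (odd ℤ.∣ ↥ q ∣ , odd (↧ₙ q))        ≡⟨ cong classOf (cancel-odd-factor _ _ (odd g) (subst Nonzero residues nz)) ⟨
  classOf (odd ℤ.∣ ↥ q ∣ ∧ odd g , odd (↧ₙ q) ∧ odd g) ≡⟨ cong classOf residues ⟨
  classOf (residue (m , suc k))               ∎
  where
  open ≡-Reasoning
  q = normalize m (suc k)
  g = gcd m (suc k)
  numerator : ℤ.∣ ↥ q ∣ * g ≡ m
  numerator = trans (sym (ℤP.abs-* (↥ q) (+ g))) (cong ℤ.∣_∣ (ℚP.↥-normalize m (suc k)))
  denominator : ↧ₙ q * g ≡ suc k
  denominator = trans (sym (ℤP.abs-* (↧ q) (+ g))) (cong ℤ.∣_∣ (ℚP.↧-normalize m (suc k)))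
  residues : residue (m , suc k) ≡ (odd ℤ.∣ ↥ q ∣ ∧ odd g , odd (↧ₙ q) ∧ odd g)
  residues = cong₂ _,_ (trans (cong odd (sym numerator)) (odd-* ℤ.∣ ↥ q ∣ g))
                       (trans (cong odd (sym denominator)) (odd-* (↧ₙ q) g))

parity-neg : ∀ q → parity (ℚ.- q) ≡ parity q
parity-neg (mkℚ (+ zero)    _ _) = refl
parity-neg (mkℚ +[1+ _ ]   _ _) = refl
parity-neg (mkℚ -[1+ _ ]   _ _) = refl

lookupOr : {A : Set} → A → List A → ℕ → A
lookupOr d []       _       = d
lookupOr d (x ∷ xs) zero    = x
lookupOr d (x ∷ xs) (suc k) = lookupOr d xs k

lookupOr-map : ∀ {A B : Set} (f : A → B) d xs k → lookupOr (f d) (map f xs) k ≡ f (lookupOr d xs k)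
lookupOr-map f d []       _       = refl
lookupOr-map f d (x ∷ xs) zero    = refl
lookupOr-map f d (x ∷ xs) (suc k) = lookupOr-map f d xs k

lookupOr-++ : ∀ {A : Set} (d : A) xs ys {k} → k < length xs → lookupOr d (xs ++ ys) k ≡ lookupOr d xs k
lookupOr-++ d (x ∷ xs) ys {zero}  _         = refl
lookupOr-++ d (x ∷ xs) ys {suc k} (s≤s k<n) = lookupOr-++ d xs ys k<n

All-lookupOr : ∀ {A : Set} {P : A → Set} {d xs} → All P xs → P d → ∀ k → P (lookupOr d xs k)
All-lookupOr []         pd _       = pd
All-lookupOr (px ∷ pxs) pd zero    = px
All-lookupOr (px ∷ pxs) pd (suc k) = All-lookupOr pxs pd k

nth-map-toℚ : ∀ l k → nth (map toℚ l) k ≡ toℚ (lookupOr (0 , 1) l k)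
nth-map-toℚ []      _       = refl
nth-map-toℚ (f ∷ l) zero    = refl
nth-map-toℚ (f ∷ l) (suc k) = nth-map-toℚ l k

sbQ⁺≡lookupOr : ∀ {k L} → k < L → sbQ⁺ k ≡ toℚ (lookupOr (0 , 1) (upToLevel L) k)
sbQ⁺≡lookupOr {k} {L} k<L with upToLevel-prefix k<L
... | r , eq = begin
  nth (map toℚ (upToLevel (suc k))) k             ≡⟨ nth-map-toℚ (upToLevel (suc k)) k ⟩
  toℚ (lookupOr (0 , 1) (upToLevel (suc k)) k)     ≡⟨ cong toℚ (lookupOr-++ (0 , 1) (upToLevel (suc k)) r (length-upToLevel (suc k))) ⟨
  toℚ (lookupOr (0 , 1) (upToLevel (suc k) ++ r) k) ≡⟨ cong (λ l → toℚ (lookupOr (0 , 1) l k)) eq ⟨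
  toℚ (lookupOr (0 , 1) (upToLevel L) k)           ∎
  where open ≡-Reasoning

Triples-rainbow : ∀ {l} d → Triples l → ∀ m → suc (suc (m * 3)) < length l →
  Rainbow (classOf (lookupOr d l (m * 3))) (classOf (lookupOr d l (suc (m * 3))))
          (classOf (lookupOr d l (suc (suc (m * 3)))))
Triples-rainbow d (b ∷ t) zero    _                    = Rainbow-classOf b
Triples-rainbow d (b ∷ t) (suc m) (s≤s (s≤s (s≤s lt))) = Triples-rainbow d t m lt

parity-sbQ⁺ : ∀ {k} L → k < L → parity (sbQ⁺ k) ≡ classOf (lookupOr [0/1] (map residue (upToLevel (L * 2))) k)
parity-sbQ⁺ {k} L k<L = begin
  parity (sbQ⁺ k)                          ≡⟨ cong parity (sbQ⁺≡lookupOr (ℕP.≤-trans k<L (ℕP.m≤m*n L 2))) ⟩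
  parity (toℚ (lookupOr (0 , 1) l k))      ≡⟨ parity-toℚ _ (All-lookupOr (All-Pos-upToLevel (L * 2)) (s≤s z≤n) k) nonzero ⟩
  classOf (residue (lookupOr (0 , 1) l k))  ≡⟨ cong classOf (lookupOr-map residue (0 , 1) l k) ⟨
  classOf (lookupOr [0/1] (map residue l) k) ∎
  where
  open ≡-Reasoning
  l = upToLevel (L * 2)
  nonzero : Nonzero (residue (lookupOr (0 , 1) l k))
  nonzero = subst Nonzero (lookupOr-map residue (0 , 1) l k)
                  (All-lookupOr (Triples-nonzero (Triples-upToLevel L)) (λ ()) k)

Rainbow-sbQ⁺ : ∀ m → Rainbow (parity (sbQ⁺ (m * 3))) (parity (sbQ⁺ (suc (m * 3)))) (parity (sbQ⁺ (suc (suc (m * 3)))))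
Rainbow-sbQ⁺ m = Rainbow-cong (parity-sbQ⁺ L (ℕP.≤-trans (ℕP.n≤1+n _) (ℕP.n≤1+n _)))
                              (parity-sbQ⁺ L (ℕP.n≤1+n _)) (parity-sbQ⁺ L ℕP.≤-refl)
                              (Triples-rainbow [0/1] (Triples-upToLevel L) m L≤length)
  where
  L = 3 + m * 3
  open ℕP.≤-Reasoning
  L≤length : L ≤ length (map residue (upToLevel (L * 2)))
  L≤length = begin
    L                                       ≤⟨ ℕP.m≤m*n L 2 ⟩
    L * 2                                   ≤⟨ length-upToLevel (L * 2) ⟩
    length (upToLevel (L * 2))              ≡⟨ ListP.length-map residue (upToLevel (L * 2)) ⟨
    length (map residue (upToLevel (L * 2))) ∎

[2k]/2≡k : ∀ k → k * 2 ℕ./ 2 ≡ k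
[2k]/2≡k k = m*n/n≡m k 2

[2k+1]/2≡k : ∀ k → suc (k * 2) ℕ./ 2 ≡ k
[2k+1]/2≡k k = trans (+-distrib-/-∣ʳ 1 {k * 2} {2} (divides-refl k)) (m*n/n≡m k 2)

parity-enumℚ : ∀ i → parity (enumℚ (suc i)) ≡ parity (sbQ⁺ (i ℕ./ 2))
parity-enumℚ i with i % 2
... | zero  = refl
... | suc _ = parity-neg (sbQ⁺ (i ℕ./ 2))

countᵇ : (ℕ → Bool) → ℕ → ℕ
countᵇ g zero    = 0
countᵇ g (suc n) = bit (g 0) + countᵇ (g ∘ suc) n

length-filterᵇ-applyUpTo : ∀ {A : Set} (p : A → Bool) (f : ℕ → A) n → length (filterᵇ p (applyUpTo f n)) ≡ countᵇ (p ∘ f) n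
length-filterᵇ-applyUpTo p f zero = refl
length-filterᵇ-applyUpTo p f (suc n) with p (f 0)
... | true  = cong suc (length-filterᵇ-applyUpTo p (f ∘ suc) n)
... | false = length-filterᵇ-applyUpTo p (f ∘ suc) n

countᵇ-snoc : ∀ g n → countᵇ g (suc n) ≡ countᵇ g n + bit (g n)
countᵇ-snoc g zero    = ℕP.+-identityʳ (bit (g 0))
countᵇ-snoc g (suc n) = trans (cong (_+_ (bit (g 0))) (countᵇ-snoc (g ∘ suc) n)) (sym (ℕP.+-assoc (bit (g 0)) _ _))

countᵇ-double : ∀ {u v} → (∀ k → u (k * 2) ≡ v k) → (∀ k → u (suc (k * 2)) ≡ v k) →
                ∀ n → countᵇ u (n * 2) ≡ countᵇ v n * 2
countᵇ-double         at-2k at-2k+1 zero    = refl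
countᵇ-double {u} {v} at-2k at-2k+1 (suc n) = begin
  bit (u 0) + (bit (u 1) + countᵇ (u ∘ suc ∘ suc) (n * 2))
    ≡⟨ cong₂ (λ a b → a + (b + _)) (cong bit (at-2k 0)) (cong bit (at-2k+1 0)) ⟩
  bit (v 0) + (bit (v 0) + countᵇ (u ∘ suc ∘ suc) (n * 2))
    ≡⟨ cong (λ c → bit (v 0) + (bit (v 0) + c)) (countᵇ-double (at-2k ∘ suc) (at-2k+1 ∘ suc) n) ⟩
  bit (v 0) + (bit (v 0) + countᵇ (v ∘ suc) n * 2)
    ≡⟨ lemma (bit (v 0)) (countᵇ (v ∘ suc) n) ⟩
  (bit (v 0) + countᵇ (v ∘ suc) n) * 2 ∎
  where
  open ≡-Reasoning
  lemma : ∀ b c → b + (b + c * 2) ≡ (b + c) * 2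
  lemma = solve-∀

countᵇ-rainbow : ∀ (p : ℕ → Parity) → (∀ m → Rainbow (p (m * 3)) (p (suc (m * 3))) (p (suc (suc (m * 3))))) →
                 ∀ c n → ∣ countᵇ (λ k → p k ≟ₚ c) n * 3 - n ∣ ≤ 2
countᵇ-rainbow p rainbow c zero = z≤n
countᵇ-rainbow p rainbow c (suc zero) with p 0 ≟ₚ c
... | true  = ℕP.≤-refl
... | false = s≤s z≤n
countᵇ-rainbow p rainbow c (suc (suc zero)) with p 0 ≟ₚ c | p 1 ≟ₚ c | rainbow 0 c
... | true  | true  | ()
... | true  | false | _ = s≤s z≤n
... | false | true  | _ = s≤s z≤n
... | false | false | _ = ℕP.≤-refl
countᵇ-rainbow p rainbow c (suc (suc (suc n))) =
  subst (λ a → ∣ a * 3 - 3 + n ∣ ≤ 2) (sym first-block) (countᵇ-rainbow (p ∘ (_+_ 3)) (rainbow ∘ suc) c n)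
  where
  g = λ k → p k ≟ₚ c
  first-block : countᵇ g (3 + n) ≡ suc (countᵇ (g ∘ (_+_ 3)) n)
  first-block = begin
    bit (g 0) + (bit (g 1) + (bit (g 2) + countᵇ (g ∘ (_+_ 3)) n)) ≡⟨ lemma (bit (g 0)) (bit (g 1)) (bit (g 2)) _ ⟩
    bit (g 0) + bit (g 1) + bit (g 2) + countᵇ (g ∘ (_+_ 3)) n     ≡⟨ cong (_+ countᵇ (g ∘ (_+_ 3)) n) (rainbow 0 c) ⟩
    suc (countᵇ (g ∘ (_+_ 3)) n)                                    ∎
    where
    open ≡-Reasoning
    lemma : ∀ a b c d → a + (b + (c + d)) ≡ a + b + c + d
    lemma = solve-∀

∣m+n-o+p∣≤∣m-o∣+∣n-p∣ : ∀ m n o p → ∣ m + n - o + p ∣ ≤ ∣ m - o ∣ + ∣ n - p ∣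
∣m+n-o+p∣≤∣m-o∣+∣n-p∣ m n o p = begin
  ∣ m + n - o + p ∣                   ≤⟨ ℕP.∣-∣-triangle (m + n) (o + n) (o + p) ⟩
  ∣ m + n - o + n ∣ + ∣ o + n - o + p ∣ ≡⟨ cong₂ _+_ (cong₂ ∣_-_∣ (ℕP.+-comm m n) (ℕP.+-comm o n)) refl ⟩
  ∣ n + m - n + o ∣ + ∣ o + n - o + p ∣ ≡⟨ cong₂ _+_ (ℕP.∣m+n-m+o∣≡∣n-o∣ n m o) (ℕP.∣m+n-m+o∣≡∣n-o∣ o n p) ⟩
  ∣ m - o ∣ + ∣ n - p ∣               ∎
  where open ℕP.≤-Reasoning

∣3bit-1∣≤2 : ∀ b → ∣ bit b * 3 - 1 ∣ ≤ 2
∣3bit-1∣≤2 false = s≤s z≤n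
∣3bit-1∣≤2 true  = ℕP.≤-refl

even-or-odd : ∀ n → ∃ λ k → n ≡ k * 2 ⊎ n ≡ suc (k * 2)
even-or-odd zero = 0 , inj₁ refl
even-or-odd (suc n) with even-or-odd n
... | k , inj₁ eq = k , inj₂ (cong suc eq)
... | k , inj₂ eq = suc k , inj₁ (cong suc eq)

countᵇ-double-bound : ∀ {u v K} → (∀ k → u (k * 2) ≡ v k) → (∀ k → u (suc (k * 2)) ≡ v k) →
                      (∀ n → ∣ countᵇ v n * 3 - n ∣ ≤ K) → ∀ n → ∣ countᵇ u n * 3 - n ∣ ≤ K * 2 + 2
countᵇ-double-bound {u} {v} {K} at-2k at-2k+1 bound n = bound-at (even-or-odd n)
  where
  open ℕP.≤-Reasoning
  doubled : ∀ k → ∣ countᵇ u (k * 2) * 3 - k * 2 ∣ ≤ K * 2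
  doubled k = begin
    ∣ countᵇ u (k * 2) * 3 - k * 2 ∣ ≡⟨ cong (λ c → ∣ c * 3 - k * 2 ∣) (countᵇ-double at-2k at-2k+1 k) ⟩
    ∣ countᵇ v k * 2 * 3 - k * 2 ∣   ≡⟨ cong (∣_- k * 2 ∣) (swap (countᵇ v k)) ⟩
    ∣ countᵇ v k * 3 * 2 - k * 2 ∣   ≡⟨ ℕP.*-distribʳ-∣-∣ 2 (countᵇ v k * 3) k ⟨
    ∣ countᵇ v k * 3 - k ∣ * 2       ≤⟨ ℕP.*-monoˡ-≤ 2 (bound k) ⟩
    K * 2                            ∎
    where
    swap : ∀ c → c * 2 * 3 ≡ c * 3 * 2
    swap = solve-∀
  bound-at : (∃ λ k → n ≡ k * 2 ⊎ n ≡ suc (k * 2)) → ∣ countᵇ u n * 3 - n ∣ ≤ K * 2 + 2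
  bound-at (k , inj₁ n≡2k) = subst (λ n → ∣ countᵇ u n * 3 - n ∣ ≤ K * 2 + 2) (sym n≡2k)
    (ℕP.≤-trans (doubled k) (ℕP.m≤m+n (K * 2) 2))
  bound-at (k , inj₂ n≡2k+1) = subst (λ n → ∣ countᵇ u n * 3 - n ∣ ≤ K * 2 + 2) (sym n≡2k+1) (begin
    ∣ countᵇ u (suc (k * 2)) * 3 - suc (k * 2) ∣
      ≡⟨ cong₂ (λ c d → ∣ c * 3 - d ∣) (countᵇ-snoc u (k * 2)) (ℕP.+-comm 1 (k * 2)) ⟩
    ∣ (countᵇ u (k * 2) + bit (u (k * 2))) * 3 - k * 2 + 1 ∣
      ≡⟨ cong (∣_- k * 2 + 1 ∣) (ℕP.*-distribʳ-+ 3 (countᵇ u (k * 2)) (bit (u (k * 2)))) ⟩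
    ∣ countᵇ u (k * 2) * 3 + bit (u (k * 2)) * 3 - k * 2 + 1 ∣
      ≤⟨ ∣m+n-o+p∣≤∣m-o∣+∣n-p∣ (countᵇ u (k * 2) * 3) (bit (u (k * 2)) * 3) (k * 2) 1 ⟩
    ∣ countᵇ u (k * 2) * 3 - k * 2 ∣ + ∣ bit (u (k * 2)) * 3 - 1 ∣
      ≤⟨ ℕP.+-mono-≤ (doubled k) (∣3bit-1∣≤2 (u (k * 2))) ⟩
    K * 2 + 2 ∎)

count-enumℚ-bound : ∀ c n → ∣ count enumℚ c (suc n) * 3 - suc n ∣ ≤ 8
count-enumℚ-bound c n = begin
  ∣ count enumℚ c (suc n) * 3 - suc n ∣
    ≡⟨ cong (λ a → ∣ a * 3 - suc n ∣) (length-filterᵇ-applyUpTo g (λ i → i) (suc n)) ⟩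
  ∣ (bit (g 0) + countᵇ u n) * 3 - 1 + n ∣
    ≡⟨ cong (∣_- 1 + n ∣) (ℕP.*-distribʳ-+ 3 (bit (g 0)) (countᵇ u n)) ⟩
  ∣ bit (g 0) * 3 + countᵇ u n * 3 - 1 + n ∣
    ≤⟨ ∣m+n-o+p∣≤∣m-o∣+∣n-p∣ (bit (g 0) * 3) (countᵇ u n * 3) 1 n ⟩
  ∣ bit (g 0) * 3 - 1 ∣ + ∣ countᵇ u n * 3 - n ∣
    ≤⟨ ℕP.+-mono-≤ (∣3bit-1∣≤2 (g 0)) (countᵇ-double-bound at-2k at-2k+1 (countᵇ-rainbow (parity ∘ sbQ⁺) Rainbow-sbQ⁺ c) n) ⟩
  8 ∎
  where
  open ℕP.≤-Reasoning
  g : ℕ → Bool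
  g i = parity (enumℚ i) ≟ₚ c
  u : ℕ → Bool
  u = g ∘ suc
  at-2k : ∀ k → u (k * 2) ≡ (parity (sbQ⁺ k) ≟ₚ c)
  at-2k k = cong (_≟ₚ c) (trans (parity-enumℚ (k * 2)) (cong (parity ∘ sbQ⁺) ([2k]/2≡k k)))
  at-2k+1 : ∀ k → u (suc (k * 2)) ≡ (parity (sbQ⁺ k) ≟ₚ c)
  at-2k+1 k = cong (_≟ₚ c) (trans (parity-enumℚ (suc (k * 2))) (cong (parity ∘ sbQ⁺) ([2k+1]/2≡k k)))

∣m⊖n∣≡∣m-n∣ : ∀ m n → ℤ.∣ m ⊖ n ∣ ≡ ∣ m - n ∣
∣m⊖n∣≡∣m-n∣ zero    n       = ℤP.∣⊖∣-≤ z≤n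
∣m⊖n∣≡∣m-n∣ (suc m) zero    = cong ℤ.∣_∣ (ℤP.⊖-≥ z≤n)
∣m⊖n∣≡∣m-n∣ (suc m) (suc n) = trans (cong ℤ.∣_∣ (ℤP.[1+m]⊖[1+n]≡m⊖n m n)) (∣m⊖n∣≡∣m-n∣ m n)

∣a/[1+n]-⅓∣≃ : ∀ a n → toℚᵘ ℚ.∣ (+ a) / suc n ℚ.- (+ 1) / 3 ∣ ℚᵘ.≃ ℚᵘ.∣ mkℚᵘ (+ a) n ℚᵘ.- mkℚᵘ (+ 1) 2 ∣
∣a/[1+n]-⅓∣≃ a n = begin
  toℚᵘ ℚ.∣ (+ a) / suc n ℚ.- (+ 1) / 3 ∣          ≈⟨ ℚP.toℚᵘ-homo-∣-∣ ((+ a) / suc n ℚ.- (+ 1) / 3) ⟩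
  ℚᵘ.∣ toℚᵘ ((+ a) / suc n ℚ.- (+ 1) / 3) ∣      ≈⟨ ℚᵘP.∣-∣-cong (ℚP.toℚᵘ-homo-+ ((+ a) / suc n) (ℚ.- ((+ 1) / 3))) ⟩
  ℚᵘ.∣ toℚᵘ ((+ a) / suc n) ℚᵘ.+ toℚᵘ (ℚ.- ((+ 1) / 3)) ∣
      ≈⟨ ℚᵘP.∣-∣-cong (ℚᵘP.+-cong (ℚP.toℚᵘ-fromℚᵘ (mkℚᵘ (+ a) n)) (ℚP.toℚᵘ-homo‿- ((+ 1) / 3))) ⟩
  ℚᵘ.∣ mkℚᵘ (+ a) n ℚᵘ.- mkℚᵘ (+ 1) 2 ∣          ∎
  where open ℚᵘP.≃-Reasoning

-- The left-hand side is ∣ 3a - (n + 1) ∣ / 3(n + 1), unnormalised.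
∣a/[1+n]-⅓∣< : ∀ a n p q → ∣ a * 3 - suc n ∣ * suc q < suc p * (suc n * 3) →
               ℚᵘ.∣ mkℚᵘ (+ a) n ℚᵘ.- mkℚᵘ (+ 1) 2 ∣ ℚᵘ.< mkℚᵘ +[1+ p ] q
∣a/[1+n]-⅓∣< a n p q lt = *<* (subst₂ ℤ._<_ lhs (sym (ℤP.pos-* (suc p) (suc n * 3))) (ℤ.+<+ lt))
  where
  numerator : (+ a) ℤ.* (+ 3) ℤ.+ -[1+ 0 ] ℤ.* (+ suc n) ≡ a * 3 ⊖ suc n
  numerator = trans (cong₂ ℤ._+_ (sym (ℤP.pos-* a 3)) (ℤP.-1*i≡-i (+ suc n))) (ℤP.m-n≡m⊖n (a * 3) (suc n))
  lhs : + (∣ a * 3 - suc n ∣ * suc q) ≡ + ℤ.∣ (+ a) ℤ.* (+ 3) ℤ.+ -[1+ 0 ] ℤ.* (+ suc n) ∣ ℤ.* (+ suc q)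
  lhs = trans (ℤP.pos-* ∣ a * 3 - suc n ∣ (suc q))
              (cong (λ z → + z ℤ.* (+ suc q)) (sym (trans (cong ℤ.∣_∣ numerator) (∣m⊖n∣≡∣m-n∣ (a * 3) (suc n)))))

HasDensity-⅓ : ∀ x c K → (∀ n → ∣ count x c (suc n) * 3 - suc n ∣ ≤ K) → HasDensity x c ((+ 1) / 3)
HasDensity-⅓ x c K bound (mkℚ +[1+ p ] q _) _ = K * suc q , λ n Kq≤n →
  ℚP.toℚᵘ-cancel-< (ℚᵘP.<-respˡ-≃ (ℚᵘP.≃-sym (∣a/[1+n]-⅓∣≃ (count x c (suc n)) n))
    (∣a/[1+n]-⅓∣< (count x c (suc n)) n p q (error-small n Kq≤n)))
  where
  open ℕP.≤-Reasoning
  error-small : ∀ n → K * suc q ≤ n → ∣ count x c (suc n) * 3 - suc n ∣ * suc q < suc p * (suc n * 3)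
  error-small n Kq≤n = begin-strict
    ∣ count x c (suc n) * 3 - suc n ∣ * suc q ≤⟨ ℕP.*-monoˡ-≤ (suc q) (bound n) ⟩
    K * suc q                                ≤⟨ Kq≤n ⟩
    n                                        <⟨ ℕP.n<1+n n ⟩
    suc n                                    ≤⟨ ℕP.m≤m*n (suc n) 3 ⟩
    suc n * 3                                ≤⟨ ℕP.m≤n*m (suc n * 3) (suc p) ⟩
    suc p * (suc n * 3)                      ∎
HasDensity-⅓ x c K bound (mkℚ (+ 0) _ _) (ℚ.*<* (ℤ.+<+ ()))
HasDensity-⅓ x c K bound (mkℚ -[1+ _ ] _ _) (ℚ.*<* ())

theorem2 : HasDensity enumℚ evenP ((+ 1) / 3) × HasDensity enumℚ oddP ((+ 1) / 3) × HasDensity enumℚ noneP ((+ 1) / 3)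
theorem2 = density evenP , density oddP , density noneP
  where
  density : ∀ c → HasDensity enumℚ c ((+ 1) / 3)
  density c = HasDensity-⅓ enumℚ c 8 (count-enumℚ-bound c)
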